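{- Each reduced signed series-parallel graph of depth at most $2$ is switching equivalent to a string.
   Context: A signed graph is a loopless graph (parallel edges allowed) with each edge labelled positive or negative. Switching at a vertex $v$ inverts the signs of all edges incident with $v$; two signed graphs are switching equivalent if one is obtained from the other by a finite sequence of switchings. Series-parallel graphs are two-terminal graphs (distinct source and target) obtained from copies of $K_2$ by iterated series connections (target of $G_i$ identified with source of $G_{i+1}$) and parallel connections (all sources identified, all targets identified). If $G$ is a series or parallel connection of series-parallel graphs $G_1,\dots,G_n$ ($n\ge2$) with $n$ maximum, the $G_i$ are the parts of $G$. $K_2^+$ and $K_2^-$ denote the positive and negative $K_2$, and $D$ the unbalanced $2$-cycle (two parallel edges, one positive and one negative). The depth is defined by $\mathrm{depth}(K_2^+)=\mathrm{depth}(K_2^-)=0$ and $\mathrm{depth}(G)=1+\max_H \mathrm{depth}(H)$ over all parts $H$ of $G$. A signed series-parallel graph is reduced if each non-terminal vertex has degree at least $3$ and there is no pair of parallel edges of the same sign. A string is a series connection of copies of $K_2^+$ and $D$ in which every non-terminal vertex is contained in a $2$-cycle. -}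

module Defs where

open import Data.Nat using (ℕ; zero; suc; _+_; _≤_; _<_; _≡ᵇ_)
open import Data.Bool using (Bool; true; false; not; if_then_else_; _∨_)
open import Data.List using (List; []; _∷_; _++_; length; map; lookup)
open import Data.Fin using (Fin)
open import Data.Product using (Σ; _×_; _,_; proj₁; proj₂; ∃)
open import Data.Sum using (_⊎_)
open import Data.Empty using (⊥)
open import Relation.Binary.PropositionalEquality using (_≡_; _≢_)
open import Data.List.Relation.Binary.Permutation.Propositional using (_↭_)

-- Signs and edges.  Sign: true = positive, false = negative.
-- Vertices are natural numbers; an edge is (u , v , sign).

Sign : Set
Sign = Bool

Edge : Set
Edge = ℕ × ℕ × Sign

-- Two-terminal signed graphs: vertices 0 .. V-1, source = 0, target = 1,
-- edges given as a list (parallel edges allowed).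

record SG : Set where
  constructor mkSG
  field
    V : ℕ
    E : List Edge
open SG public

source target : ℕ
source = 0
target = 1

-- Series-parallel terms.
--   leaf s   : a copy of K₂ with sign s
--   ser Gs   : series connection of the list Gs (in order)
--   par Gs   : parallel connection of the list Gs

data SP : Set where
  leaf : Sign → SP
  ser  : List SP → SP
  par  : List SP → SP

isSer isPar : SP → Bool
isSer (ser _) = true
isSer _       = false
isPar (par _) = true
isPar _       = false

-- Canonical (maximal) decomposition: every series/parallel node has at
-- least two parts, and the parts of a series (parallel) connection are not
-- themselves series (parallel) connections, i.e. the number n of parts is
-- maximum.  Then the children of a node are exactly the parts of the graph.
mutual
  data Canonical : SP → Set where
    c-leaf : ∀ s → Canonical (leaf s)
    c-ser  : ∀ {Gs} → 2 ≤ length Gs → AllCanon false Gs → Canonical (ser Gs)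
    c-par  : ∀ {Gs} → 2 ≤ length Gs → AllCanon true Gs → Canonical (par Gs)

  data AllCanon : Bool → List SP → Set where
    []  : ∀ {b} → AllCanon b []
    _∷_ : ∀ {b G Gs} → Canonical G →
          (if b then isPar G else isSer G) ≡ false →
          AllCanon b Gs → AllCanon b (G ∷ Gs)

mutual
  depth : SP → ℕ
  depth (leaf _) = 0
  depth (ser Gs) = suc (depthList Gs)
  depth (par Gs) = suc (depthList Gs)

  depthList : List SP → ℕ
  depthList []       = 0
  depthList (G ∷ Gs) = depth G Data.Nat.⊔ depthList Gs

-- Realisation of a term as a concrete graph.
-- build G s t k : edges of G with source s and target t, using fresh
-- vertices k, k+1, ...; also returns the next unused vertex.

mutual
  build : SP → ℕ → ℕ → ℕ → List Edge × ℕ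
  build (leaf σ) s t k = (s , t , σ) ∷ [] , k
  build (ser Gs) s t k = buildSer Gs s t k
  build (par Gs) s t k = buildPar Gs s t k

  buildSer : List SP → ℕ → ℕ → ℕ → List Edge × ℕ
  buildSer []             s t k = [] , k
  buildSer (G ∷ [])       s t k = build G s t k
  buildSer (G ∷ H ∷ Gs)   s t k =
    let r₁ = build G s k (suc k)
        r₂ = buildSer (H ∷ Gs) k t (proj₂ r₁)
    in proj₁ r₁ ++ proj₁ r₂ , proj₂ r₂

  buildPar : List SP → ℕ → ℕ → ℕ → List Edge × ℕ
  buildPar []       s t k = [] , k
  buildPar (G ∷ Gs) s t k =
    let r₁ = build G s t k
        r₂ = buildPar Gs s t (proj₂ r₁)
    in proj₁ r₁ ++ proj₁ r₂ , proj₂ r₂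

graphOf : SP → SG
graphOf G = let r = build G source target 2 in mkSG (proj₂ r) (proj₁ r)

-- degree of v (graphs here are loopless)
deg : ℕ → List Edge → ℕ
deg v []                = 0
deg v ((a , b , _) ∷ es) = (if (a ≡ᵇ v) ∨ (b ≡ᵇ v) then 1 else 0) + deg v es

SameEnds : Edge → Edge → Set
SameEnds (a , b , _) (c , d , _) = (a ≡ c × b ≡ d) ⊎ (a ≡ d × b ≡ c)

sign : Edge → Sign
sign (_ , _ , σ) = σ

NonTerminal : SG → ℕ → Set
NonTerminal G v = 2 ≤ v × v < V G

Reduced : SG → Set
Reduced G =
  (∀ v → NonTerminal G v → 3 ≤ deg v (E G)) ×
  (∀ (i j : Fin (length (E G))) → i ≢ j →
     SameEnds (lookup (E G) i) (lookup (E G) j) →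
     sign (lookup (E G) i) ≡ sign (lookup (E G) j) → ⊥)

InTwoCycle : SG → ℕ → Set
InTwoCycle G v =
  Σ (Fin (length (E G))) λ i → Σ (Fin (length (E G))) λ j → Σ ℕ λ w →
    i ≢ j ×
    SameEnds (lookup (E G) i) (v , w , true) ×
    SameEnds (lookup (E G) j) (v , w , true)

flipAt : ℕ → Edge → Edge
flipAt v (a , b , σ) = a , b , (if (a ≡ᵇ v) ∨ (b ≡ᵇ v) then not σ else σ)

switchAt : ℕ → SG → SG
switchAt v G = mkSG (V G) (map (flipAt v) (E G))

data SwitchEq (G : SG) : SG → Set where
  sw-refl : SwitchEq G G
  sw-step : ∀ {H} v → v < V H → SwitchEq G H → SwitchEq G (switchAt v H)

norm : Edge → Edge
norm (a , b , σ) = (a Data.Nat.⊓ b) , (a Data.Nat.⊔ b) , σ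

ren : (ℕ → ℕ) → Edge → Edge
ren π (a , b , σ) = π a , π b , σ

Iso : SG → SG → Set
Iso G H =
  V G ≡ V H ×
  Σ (ℕ → ℕ) λ π → Σ (ℕ → ℕ) λ ρ →
    (∀ x → ρ (π x) ≡ x) × (∀ x → π (ρ x) ≡ x) ×
    π source ≡ source × π target ≡ target ×
    (∀ x → x < V G → π x < V H) ×
    (map (λ e → norm (ren π e)) (E G) ↭ map norm (E H))

data Piece : Set where
  K2+ : Piece
  Dcyc : Piece

pieceSP : Piece → SP
pieceSP K2+  = leaf true
pieceSP Dcyc = par (leaf true ∷ leaf false ∷ [])

stringGraph : List Piece → SG
stringGraph ps = graphOf (ser (map pieceSP ps))

IsString : SG → Set
IsString H =
  Σ (List Piece) λ ps →
    ps ≢ [] ×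
    (∀ v → NonTerminal (stringGraph ps) v → InTwoCycle (stringGraph ps) v) ×
    Iso H (stringGraph ps)

-- A reduced graph has no inner vertex of degree 2 and no two parallel edges of the same
-- sign.  In depth at most 2 the parts have depth at most 1, and these two facts pin the graph
-- down: a parallel connection can only have single edges as parts, so it is D itself; a series
-- connection has single edges and copies of D as parts, never two single edges in a row.
-- Such a chain is switched into a string by a potential on its vertices, obtained by walking
-- from the source and flipping the running value across every negative edge: switching at
-- the vertices of value true makes every single edge positive and leaves every copy of D a
-- copy of D, possibly with its two edges exchanged.  Every inner vertex of the chain lies on
-- a copy of D, that is, in a 2-cycle.

module Submission where

open import Defs
open import Data.Nat using (_≤_)
open import Data.Product using (Σ; _×_)
open import Data.Nat using (ℕ; zero; suc; _+_; _<_; _≡ᵇ_; s≤s; z<s; s<s)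
open import Data.Nat.Properties using (≤-refl; ≤-trans; <⇒≤; <-trans; <-≤-trans; <-irrefl; <⇒≢; >⇒≢; n<1+n; n≤1+n; m<n⇒m<1+n; +-assoc; m≤n⇒m<n∨m≡n; m⊔n≤o⇒m≤o; m⊔n≤o⇒n≤o; ≡ᵇ⇒≡; ≡⇒≡ᵇ)
open import Data.Bool using (Bool; true; false; not; _∧_; _∨_; _xor_; if_then_else_)
import Data.Bool as Bool
open import Data.Bool.Properties using (T-≡; ¬-not; not-distribˡ-xor; not-distribʳ-xor; xor-identityʳ; xor-inverseʳ)
open import Data.List using (List; []; _∷_; _++_; length; map; lookup)
open import Data.List.Properties using (map-∘; map-id; map-++; map-cong-local)
open import Data.List.Relation.Unary.All as All using (All; []; _∷_)
import Data.List.Relation.Unary.All.Properties as AllP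
open import Data.List.Relation.Unary.Any as Any using (Any; here; there)
import Data.List.Relation.Unary.Any.Properties as AnyP
open import Data.List.Relation.Binary.Permutation.Propositional using (_↭_; ↭-refl; swap)
import Data.List.Relation.Binary.Permutation.Propositional.Properties as PermP
open import Data.Fin using (Fin; zero; suc)
import Data.Fin.Properties as FinP
open import Data.Product using (_,_; proj₁; proj₂)
open import Data.Sum using (_⊎_; inj₁; inj₂; [_,_]′)
open import Data.Empty using (⊥-elim)
open import Data.Unit using (⊤; tt)
open import Function using (_∘_; Equivalence)
open import Relation.Nullary using (¬_; yes; no)
open import Relation.Binary.PropositionalEquality using (_≡_; _≢_; refl; sym; trans; cong; cong₂; subst; subst₂; ≢-sym)

≡ᵇ⇒≡′ : ∀ m n → (m ≡ᵇ n) ≡ true → m ≡ n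
≡ᵇ⇒≡′ m n eq = ≡ᵇ⇒≡ m n (Equivalence.from T-≡ eq)

≡ᵇ-refl : ∀ n → (n ≡ᵇ n) ≡ true
≡ᵇ-refl n = Equivalence.to T-≡ (≡⇒≡ᵇ n n refl)

≢⇒≡ᵇ-false : ∀ {m n} → m ≢ n → (m ≡ᵇ n) ≡ false
≢⇒≡ᵇ-false {m} {n} m≢n = ¬-not (m≢n ∘ ≡ᵇ⇒≡′ m n)

¬3≤2 : ¬ 3 ≤ 2
¬3≤2 (s≤s (s≤s ()))

Avoid : ℕ → Edge → Set
Avoid v (a , b , _) = a ≢ v × b ≢ v

Loopless : Edge → Set
Loopless (a , b , _) = a ≢ b

Below : ℕ → Edge → Set
Below n (a , b , _) = a < n × b < n

data SomePair (R : Edge → Edge → Set) : List Edge → Set where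
  here  : ∀ {e es} → Any (R e) es → SomePair R (e ∷ es)
  there : ∀ {e es} → SomePair R es → SomePair R (e ∷ es)

somePair-indices : ∀ {R es} → SomePair R es →
  Σ (Fin (length es)) λ i → Σ (Fin (length es)) λ j → i ≢ j × R (lookup es i) (lookup es j)
somePair-indices (here r) = zero , suc (Any.index r) , (λ ()) , AnyP.lookup-index r
somePair-indices (there p) with somePair-indices p
... | i , j , i≢j , r = suc i , suc j , i≢j ∘ FinP.suc-injective , r

somePair-++ˡ : ∀ {R xs} ys → SomePair R xs → SomePair R (xs ++ ys)
somePair-++ˡ ys (here r) = here (AnyP.++⁺ˡ r)
somePair-++ˡ ys (there p) = there (somePair-++ˡ ys p)

somePair-++ʳ : ∀ {R} xs {ys} → SomePair R ys → SomePair R (xs ++ ys)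
somePair-++ʳ [] p = p
somePair-++ʳ (x ∷ xs) p = there (somePair-++ʳ xs p)

deg-++ : ∀ v xs ys → deg v (xs ++ ys) ≡ deg v xs + deg v ys
deg-++ v [] ys = refl
deg-++ v ((a , b , _) ∷ xs) ys =
  trans (cong (_ +_) (deg-++ v xs ys)) (sym (+-assoc (if (a ≡ᵇ v) ∨ (b ≡ᵇ v) then 1 else 0) _ _))

deg-avoided : ∀ {v es} → All (Avoid v) es → deg v es ≡ 0
deg-avoided [] = refl
deg-avoided {es = (a , b , _) ∷ _} ((a≢v , b≢v) ∷ avoid)
  rewrite ≢⇒≡ᵇ-false a≢v | ≢⇒≡ᵇ-false b≢v = deg-avoided avoid

data Within (s t lo hi x : ℕ) : Set where
  at-source : x ≡ s → Within s t lo hi x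
  at-target : x ≡ t → Within s t lo hi x
  fresh     : lo ≤ x → x < hi → Within s t lo hi x

EdgeWithin : ℕ → ℕ → ℕ → ℕ → Edge → Set
EdgeWithin s t lo hi (a , b , _) = Within s t lo hi a × Within s t lo hi b

edgeWithin-mono : ∀ {s t lo hi s′ t′ lo′ hi′} →
  (∀ {x} → Within s t lo hi x → Within s′ t′ lo′ hi′ x) →
  ∀ {e} → EdgeWithin s t lo hi e → EdgeWithin s′ t′ lo′ hi′ e
edgeWithin-mono f {_ , _ , _} (a∈ , b∈) = f a∈ , f b∈

-- The sign of an edge is invisible to EdgeWithin and Avoid, so All.map needs the edge explicitly.
within-avoid : ∀ {s t lo hi v es} → All (EdgeWithin s t lo hi) es →
  s ≢ v → t ≢ v → v < lo ⊎ hi ≤ v → All (Avoid v) es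
within-avoid {s} {t} {lo} {hi} {v} within s≢v t≢v outside = All.map (λ {e} → avoid {e}) within
  where
    avoid-vertex : ∀ {x} → Within s t lo hi x → x ≢ v
    avoid-vertex (at-source refl) = s≢v
    avoid-vertex (at-target refl) = t≢v
    avoid-vertex (fresh lo≤x x<hi) refl =
      [ (λ v<lo → <-irrefl refl (<-≤-trans v<lo lo≤x))
      , (λ hi≤v → <-irrefl refl (<-≤-trans x<hi hi≤v)) ]′ outside

    avoid : ∀ {e} → EdgeWithin s t lo hi e → Avoid v e
    avoid {_ , _ , _} (a∈ , b∈) = avoid-vertex a∈ , avoid-vertex b∈

within-below : ∀ {s t lo hi es} → s < hi → t < hi → All (EdgeWithin s t lo hi) es → All (Below hi) es
within-below {s} {t} {lo} {hi} s<hi t<hi = All.map (λ {e} → below {e})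
  where
    vertex-below : ∀ {x} → Within s t lo hi x → x < hi
    vertex-below (at-source refl) = s<hi
    vertex-below (at-target refl) = t<hi
    vertex-below (fresh _ x<hi)   = x<hi

    below : ∀ {e} → EdgeWithin s t lo hi e → Below hi e
    below {_ , _ , _} (a∈ , b∈) = vertex-below a∈ , vertex-below b∈

mutual
  build-≤ : ∀ G s t k → k ≤ proj₂ (build G s t k)
  build-≤ (leaf _) s t k = ≤-refl
  build-≤ (ser Gs) s t k = buildSer-≤ Gs s t k
  build-≤ (par Gs) s t k = buildPar-≤ Gs s t k

  buildSer-≤ : ∀ Gs s t k → k ≤ proj₂ (buildSer Gs s t k)
  buildSer-≤ [] s t k = ≤-refl
  buildSer-≤ (G ∷ []) s t k = build-≤ G s t k
  buildSer-≤ (G ∷ H ∷ Gs) s t k =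
    ≤-trans (n≤1+n k) (≤-trans (build-≤ G s k (suc k)) (buildSer-≤ (H ∷ Gs) k t _))

  buildPar-≤ : ∀ Gs s t k → k ≤ proj₂ (buildPar Gs s t k)
  buildPar-≤ [] s t k = ≤-refl
  buildPar-≤ (G ∷ Gs) s t k = ≤-trans (build-≤ G s t k) (buildPar-≤ Gs s t _)

mutual
  build-within : ∀ G s t k → All (EdgeWithin s t k (proj₂ (build G s t k))) (proj₁ (build G s t k))
  build-within (leaf _) s t k = (at-source refl , at-target refl) ∷ []
  build-within (ser Gs) s t k = buildSer-within Gs s t k
  build-within (par Gs) s t k = buildPar-within Gs s t k

  buildSer-within : ∀ Gs s t k →
    All (EdgeWithin s t k (proj₂ (buildSer Gs s t k))) (proj₁ (buildSer Gs s t k))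
  buildSer-within [] s t k = []
  buildSer-within (G ∷ []) s t k = build-within G s t k
  buildSer-within (G ∷ H ∷ Gs) s t k =
    AllP.++⁺ (All.map (λ {e} → edgeWithin-mono first {e}) (build-within G s k (suc k)))
             (All.map (λ {e} → edgeWithin-mono rest {e}) (buildSer-within (H ∷ Gs) k t c₁))
    where
      c₁ = proj₂ (build G s k (suc k))
      c₂ = proj₂ (buildSer (H ∷ Gs) k t c₁)
      k<c₁ : k < c₁
      k<c₁ = build-≤ G s k (suc k)
      k<c₂ : k < c₂
      k<c₂ = <-≤-trans k<c₁ (buildSer-≤ (H ∷ Gs) k t c₁)

      first : ∀ {x} → Within s k (suc k) c₁ x → Within s t k c₂ x
      first (at-source x≡s) = at-source x≡s
      first (at-target refl) = fresh ≤-refl k<c₂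
      first (fresh k<x x<c₁) =
        fresh (<⇒≤ k<x) (<-≤-trans x<c₁ (buildSer-≤ (H ∷ Gs) k t c₁))

      rest : ∀ {x} → Within k t c₁ c₂ x → Within s t k c₂ x
      rest (at-source refl) = fresh ≤-refl k<c₂
      rest (at-target x≡t) = at-target x≡t
      rest (fresh c₁≤x x<c₂) = fresh (≤-trans (<⇒≤ k<c₁) c₁≤x) x<c₂

  buildPar-within : ∀ Gs s t k →
    All (EdgeWithin s t k (proj₂ (buildPar Gs s t k))) (proj₁ (buildPar Gs s t k))
  buildPar-within [] s t k = []
  buildPar-within (G ∷ Gs) s t k =
    AllP.++⁺ (All.map (λ {e} → edgeWithin-mono first {e}) (build-within G s t k))
             (All.map (λ {e} → edgeWithin-mono rest {e}) (buildPar-within Gs s t c₁))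
    where
      c₁ = proj₂ (build G s t k)
      c₂ = proj₂ (buildPar Gs s t c₁)

      first : ∀ {x} → Within s t k c₁ x → Within s t k c₂ x
      first (at-source x≡s) = at-source x≡s
      first (at-target x≡t) = at-target x≡t
      first (fresh k≤x x<c₁) = fresh k≤x (<-≤-trans x<c₁ (buildPar-≤ Gs s t c₁))

      rest : ∀ {x} → Within s t c₁ c₂ x → Within s t k c₂ x
      rest (at-source x≡s) = at-source x≡s
      rest (at-target x≡t) = at-target x≡t
      rest (fresh c₁≤x x<c₂) = fresh (≤-trans (build-≤ G s t k) c₁≤x) x<c₂

build-avoids-beyond : ∀ G s t k v → s < v → t < v → proj₂ (build G s t k) ≤ v →
  All (Avoid v) (proj₁ (build G s t k))
build-avoids-beyond G s t k v s<v t<v next≤v =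
  within-avoid (build-within G s t k) (<⇒≢ s<v) (<⇒≢ t<v) (inj₂ next≤v)

mutual
  build-loopless : ∀ G s t k → s ≢ t → s < k → t < k → All Loopless (proj₁ (build G s t k))
  build-loopless (leaf _) s t k s≢t _ _ = s≢t ∷ []
  build-loopless (ser Gs) = buildSer-loopless Gs
  build-loopless (par Gs) = buildPar-loopless Gs

  buildSer-loopless : ∀ Gs s t k → s ≢ t → s < k → t < k → All Loopless (proj₁ (buildSer Gs s t k))
  buildSer-loopless [] s t k _ _ _ = []
  buildSer-loopless (G ∷ []) = build-loopless G
  buildSer-loopless (G ∷ H ∷ Gs) s t k s≢t s<k t<k =
    AllP.++⁺ (build-loopless G s k (suc k) (<⇒≢ s<k) (m<n⇒m<1+n s<k) (n<1+n k))
             (buildSer-loopless (H ∷ Gs) k t _ (>⇒≢ t<k) k<c₁ (<-trans t<k k<c₁))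
    where
      k<c₁ : k < proj₂ (build G s k (suc k))
      k<c₁ = build-≤ G s k (suc k)

  buildPar-loopless : ∀ Gs s t k → s ≢ t → s < k → t < k → All Loopless (proj₁ (buildPar Gs s t k))
  buildPar-loopless [] s t k _ _ _ = []
  buildPar-loopless (G ∷ Gs) s t k s≢t s<k t<k =
    AllP.++⁺ (build-loopless G s t k s≢t s<k t<k)
             (buildPar-loopless Gs s t _ s≢t (<-≤-trans s<k k≤c₁) (<-≤-trans t<k k≤c₁))
    where
      k≤c₁ : k ≤ proj₂ (build G s t k)
      k≤c₁ = build-≤ G s t k

series-leaf-leaf-deg : ∀ a b Gs s t k → s ≢ k → t ≢ k →
  deg k (proj₁ (buildSer (leaf a ∷ leaf b ∷ Gs) s t k)) ≡ 2
series-leaf-leaf-deg a b [] s t k s≢k t≢k rewrite ≢⇒≡ᵇ-false s≢k | ≡ᵇ-refl k = refl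
series-leaf-leaf-deg a b (G ∷ Gs) s t k s≢k t≢k rewrite ≢⇒≡ᵇ-false s≢k | ≡ᵇ-refl k =
  cong (2 +_) (deg-avoided (within-avoid (buildSer-within (G ∷ Gs) (suc k) t (suc (suc k)))
    (>⇒≢ (n<1+n k)) t≢k (inj₁ (m<n⇒m<1+n (n<1+n k)))))

Duplicate : Edge → Edge → Set
Duplicate e e′ = SameEnds e e′ × sign e ≡ sign e′

LocallyReduced : List Edge → ℕ → ℕ → Set
LocallyReduced es lo hi = (∀ v → lo ≤ v → v < hi → 3 ≤ deg v es) × ¬ SomePair Duplicate es

reduced⇒locallyReduced : ∀ G → Reduced G → LocallyReduced (E G) 2 (V G)
reduced⇒locallyReduced G (deg≥3 , noDup) = (λ v 2≤v v<V → deg≥3 v (2≤v , v<V)) , noDuplicate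
  where
    noDuplicate : ¬ SomePair Duplicate (E G)
    noDuplicate p with somePair-indices p
    ... | i , j , i≢j , sameEnds , sameSign = noDup i j i≢j sameEnds sameSign

locallyReduced-suffix : ∀ xs {ys lo lo′ hi} → lo ≤ lo′ → (∀ v → lo′ ≤ v → All (Avoid v) xs) →
  LocallyReduced (xs ++ ys) lo hi → LocallyReduced ys lo′ hi
locallyReduced-suffix xs {ys} {lo} {lo′} {hi} lo≤lo′ avoid (deg≥3 , noDup) =
  deg≥3′ , noDup ∘ somePair-++ʳ xs
  where
    deg≥3′ : ∀ v → lo′ ≤ v → v < hi → 3 ≤ deg v ys
    deg≥3′ v lo′≤v v<hi = subst (3 ≤_) deg-suffix (deg≥3 v (≤-trans lo≤lo′ lo′≤v) v<hi)
      where
        deg-suffix : deg v (xs ++ ys) ≡ deg v ys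
        deg-suffix = trans (deg-++ v xs ys) (cong (_+ deg v ys) (deg-avoided (avoid v lo′≤v)))

locallyReduced-dropFirst : ∀ G s k {ys hi} → s < k →
  LocallyReduced (proj₁ (build G s k (suc k)) ++ ys) k hi →
  LocallyReduced ys (proj₂ (build G s k (suc k))) hi
locallyReduced-dropFirst G s k s<k = locallyReduced-suffix (proj₁ (build G s k (suc k))) (<⇒≤ k<c₁) avoid
  where
    c₁ = proj₂ (build G s k (suc k))
    k<c₁ : k < c₁
    k<c₁ = build-≤ G s k (suc k)
    avoid : ∀ v → c₁ ≤ v → All (Avoid v) (proj₁ (build G s k (suc k)))
    avoid v c₁≤v =
      build-avoids-beyond G s k (suc k) v (<-trans s<k (<-≤-trans k<c₁ c₁≤v)) (<-≤-trans k<c₁ c₁≤v) c₁≤v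

IsLeaf : SP → Set
IsLeaf G = Σ Sign λ σ → G ≡ leaf σ

depth≤0⇒leaf : ∀ G → depth G ≤ 0 → IsLeaf G
depth≤0⇒leaf (leaf σ) _ = σ , refl

depth≤0⇒leaves : ∀ Gs → depthList Gs ≤ 0 → All IsLeaf Gs
depth≤0⇒leaves [] _ = []
depth≤0⇒leaves (G ∷ Gs) d =
  depth≤0⇒leaf G (m⊔n≤o⇒m≤o (depth G) _ d) ∷ depth≤0⇒leaves Gs (m⊔n≤o⇒n≤o (depth G) _ d)

data Shallow : SP → Set where
  single   : ∀ σ → Shallow (leaf σ)
  series   : ∀ {Gs} → 2 ≤ length Gs → All IsLeaf Gs → Shallow (ser Gs)
  parallel : ∀ {Gs} → 2 ≤ length Gs → All IsLeaf Gs → Shallow (par Gs)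

canonical⇒shallow : ∀ {G} → Canonical G → depth G ≤ 1 → Shallow G
canonical⇒shallow (c-leaf σ) _ = single σ
canonical⇒shallow (c-ser {Gs} len _) (s≤s d) = series len (depth≤0⇒leaves Gs d)
canonical⇒shallow (c-par {Gs} len _) (s≤s d) = parallel len (depth≤0⇒leaves Gs d)

ShallowPart : Bool → SP → Set
ShallowPart b G = Shallow G × (if b then isPar G else isSer G) ≡ false

allCanon⇒shallow : ∀ {b Gs} → AllCanon b Gs → depthList Gs ≤ 1 → All (ShallowPart b) Gs
allCanon⇒shallow [] _ = []
allCanon⇒shallow {Gs = G ∷ Gs} (_∷_ canon notSame canons) d =
  (canonical⇒shallow canon (m⊔n≤o⇒m≤o (depth G) _ d) , notSame) ∷
  allCanon⇒shallow canons (m⊔n≤o⇒n≤o (depth G) _ d)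

parallelParts-leaves : ∀ Gs s t k → s < k → t < k → All (ShallowPart true) Gs →
  LocallyReduced (proj₁ (buildPar Gs s t k)) k (proj₂ (buildPar Gs s t k)) → All IsLeaf Gs
parallelParts-leaves [] s t k _ _ [] _ = []
parallelParts-leaves (leaf σ ∷ Gs) s t k s<k t<k (_ ∷ parts) reduced =
  (σ , refl) ∷ parallelParts-leaves Gs s t k s<k t<k parts
                 (locallyReduced-suffix ((s , t , σ) ∷ []) ≤-refl avoid reduced)
  where
    avoid : ∀ v → k ≤ v → All (Avoid v) ((s , t , σ) ∷ [])
    avoid v k≤v = (<⇒≢ (<-≤-trans s<k k≤v) , <⇒≢ (<-≤-trans t<k k≤v)) ∷ []
parallelParts-leaves (ser _ ∷ Gs) s t k s<k t<k
  ((series {_ ∷ _ ∷ rest} _ ((a , refl) ∷ (b , refl) ∷ _) , _) ∷ _) (deg≥3 , _) =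
  ⊥-elim (¬3≤2 (subst (3 ≤_) deg≡2 (deg≥3 k ≤-refl k<next)))
  where
    first = proj₁ (buildSer (leaf a ∷ leaf b ∷ rest) s t k)
    c₁ = proj₂ (buildSer (leaf a ∷ leaf b ∷ rest) s t k)
    k<c₁ : k < c₁
    k<c₁ = buildSer-≤ (leaf b ∷ rest) k t (suc k)
    k<next : k < proj₂ (buildPar Gs s t c₁)
    k<next = <-≤-trans k<c₁ (buildPar-≤ Gs s t c₁)
    deg≡2 : deg k (first ++ proj₁ (buildPar Gs s t c₁)) ≡ 2
    deg≡2 = trans (deg-++ k first _)
      (cong₂ _+_ (series-leaf-leaf-deg a b rest s t k (<⇒≢ s<k) (<⇒≢ t<k))
                 (deg-avoided (within-avoid (buildPar-within Gs s t c₁) (<⇒≢ s<k) (<⇒≢ t<k) (inj₁ k<c₁))))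
parallelParts-leaves (ser (_ ∷ []) ∷ _) s t k _ _ ((series (s≤s ()) _ , _) ∷ _) _
parallelParts-leaves (par _ ∷ _) s t k _ _ ((_ , ()) ∷ _) _

data Block : Set where
  edge  : Sign → Block
  digon : Sign → Block

blockSP : Block → SP
blockSP (edge σ)  = leaf σ
blockSP (digon a) = par (leaf a ∷ leaf (not a) ∷ [])

chainGraph : Block → List Block → SG
chainGraph c cs = graphOf (ser (map blockSP (c ∷ cs)))

isEdge : Block → Bool
isEdge (edge _)  = true
isEdge (digon _) = false

NoAdjacentEdges : Block → List Block → Set
NoAdjacentEdges c []       = ⊤
NoAdjacentEdges c (d ∷ cs) = isEdge c ∧ isEdge d ≡ false × NoAdjacentEdges d cs

three-signs : ∀ (a b c : Sign) → a ≡ b ⊎ a ≡ c ⊎ b ≡ c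
three-signs true  true  _     = inj₁ refl
three-signs false false _     = inj₁ refl
three-signs true  false true  = inj₂ (inj₁ refl)
three-signs false true  false = inj₂ (inj₁ refl)
three-signs true  false false = inj₂ (inj₂ refl)
three-signs false true  true  = inj₂ (inj₂ refl)

leaves-digon : ∀ Gs s t k → 2 ≤ length Gs → All IsLeaf Gs →
  ¬ SomePair Duplicate (proj₁ (buildPar Gs s t k)) → Σ Sign λ a → Gs ≡ leaf a ∷ leaf (not a) ∷ []
leaves-digon (_ ∷ []) s t k (s≤s ()) _ _
leaves-digon (_ ∷ _ ∷ []) s t k _ ((a , refl) ∷ (b , refl) ∷ []) noDup with a Bool.≟ b
... | yes a≡b = ⊥-elim (noDup (here (here (inj₁ (refl , refl) , a≡b))))
... | no a≢b  = a , cong (λ σ → leaf a ∷ leaf σ ∷ []) (¬-not (≢-sym a≢b))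
leaves-digon (_ ∷ _ ∷ _ ∷ _) s t k _ ((a , refl) ∷ (b , refl) ∷ (c , refl) ∷ _) noDup =
  ⊥-elim (noDup (duplicate (three-signs a b c)))
  where
    duplicate : a ≡ b ⊎ a ≡ c ⊎ b ≡ c → SomePair Duplicate _
    duplicate (inj₁ a≡b)         = here (here (inj₁ (refl , refl) , a≡b))
    duplicate (inj₂ (inj₁ a≡c))  = here (there (here (inj₁ (refl , refl) , a≡c)))
    duplicate (inj₂ (inj₂ b≡c))  = there (here (here (inj₁ (refl , refl) , b≡c)))

shallow-block : ∀ {G} s t k → ShallowPart false G → ¬ SomePair Duplicate (proj₁ (build G s t k)) →
  Σ Block λ c → G ≡ blockSP c
shallow-block s t k (single σ , _) _ = edge σ , refl
shallow-block s t k (parallel {Gs} len leaves , _) noDup with leaves-digon Gs s t k len leaves noDup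
... | a , refl = digon a , refl

adjacent-not-edges : ∀ c d cs s t k hi → s < k → t < k → k < hi →
  LocallyReduced (proj₁ (buildSer (blockSP c ∷ blockSP d ∷ map blockSP cs) s t k)) k hi →
  isEdge c ∧ isEdge d ≡ false
adjacent-not-edges (edge a) (edge b) cs s t k hi s<k t<k k<hi (deg≥3 , _) =
  ⊥-elim (¬3≤2 (subst (3 ≤_) (series-leaf-leaf-deg a b (map blockSP cs) s t k (<⇒≢ s<k) (<⇒≢ t<k))
                           (deg≥3 k ≤-refl k<hi)))
adjacent-not-edges (edge _)  (digon _) _ _ _ _ _ _ _ _ _ = refl
adjacent-not-edges (digon _) _         _ _ _ _ _ _ _ _ _ = refl

seriesParts-chain : ∀ G Gs s t k → s < k → t < k → All (ShallowPart false) (G ∷ Gs) →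
  LocallyReduced (proj₁ (buildSer (G ∷ Gs) s t k)) k (proj₂ (buildSer (G ∷ Gs) s t k)) →
  Σ Block λ c → Σ (List Block) λ cs → G ∷ Gs ≡ map blockSP (c ∷ cs) × NoAdjacentEdges c cs
seriesParts-chain G [] s t k _ _ (part ∷ []) (_ , noDup) with shallow-block s t k part noDup
... | c , refl = c , [] , refl , tt
seriesParts-chain G (H ∷ Gs) s t k s<k t<k (part ∷ parts) reduced
  with shallow-block s k (suc k) part (proj₂ reduced ∘ somePair-++ˡ _)
     | seriesParts-chain H Gs k t _ (build-≤ G s k (suc k)) (<-trans t<k (build-≤ G s k (suc k))) parts
         (locallyReduced-dropFirst G s k s<k reduced)
... | c , refl | d , cs , refl , noAdj =
  c , d ∷ cs , refl ,
  (adjacent-not-edges c d cs s t k _ s<k t<k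
     (<-≤-trans (build-≤ (blockSP c) s k (suc k)) (buildSer-≤ (blockSP d ∷ map blockSP cs) k t _)) reduced
  , noAdj)

reduced-depth≤2-chain : ∀ G → Canonical G → depth G ≤ 2 → Reduced (graphOf G) →
  Σ Block λ c → Σ (List Block) λ cs → NoAdjacentEdges c cs × graphOf G ≡ chainGraph c cs
reduced-depth≤2-chain (leaf σ) _ _ _ = edge σ , [] , tt , refl
reduced-depth≤2-chain (par Gs) (c-par len parts) (s≤s d) red
  with reduced⇒locallyReduced (graphOf (par Gs)) red
... | reduced
  with leaves-digon Gs 0 1 2 len
         (parallelParts-leaves Gs 0 1 2 z<s (s<s z<s) (allCanon⇒shallow parts d) reduced) (proj₂ reduced)
... | a , refl = digon a , [] , tt , refl
reduced-depth≤2-chain (ser []) (c-ser () _) _ _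
reduced-depth≤2-chain (ser (G ∷ Gs)) (c-ser _ parts) (s≤s d) red
  with seriesParts-chain G Gs 0 1 2 z<s (s<s z<s) (allCanon⇒shallow parts d) (reduced⇒locallyReduced _ red)
... | c , cs , refl , noAdj = c , cs , noAdj , refl

switchBy : (ℕ → Bool) → Edge → Edge
switchBy h (a , b , σ) = a , b , (σ xor h a) xor h b

switchAll : List ℕ → Edge → Edge
switchAll []       e = e
switchAll (v ∷ vs) e = flipAt v (switchAll vs e)

parity : List ℕ → ℕ → Bool
parity []       x = false
parity (v ∷ vs) x = (x ≡ᵇ v) xor parity vs x

switchAll-parity : ∀ vs {a b} σ → a ≢ b → switchAll vs (a , b , σ) ≡ switchBy (parity vs) (a , b , σ)
switchAll-parity [] σ _ = cong (λ τ → _ , _ , τ) (sym (trans (xor-identityʳ _) (xor-identityʳ σ)))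
switchAll-parity (v ∷ vs) {a} {b} σ a≢b rewrite switchAll-parity vs σ a≢b
  with a ≡ᵇ v in a≡ᵇv | b ≡ᵇ v in b≡ᵇv
... | true  | true  = ⊥-elim (a≢b (trans (≡ᵇ⇒≡′ a v a≡ᵇv) (sym (≡ᵇ⇒≡′ b v b≡ᵇv))))
... | true  | false = cong (λ τ → a , b , τ)
  (trans (not-distribˡ-xor (σ xor parity vs a) (parity vs b))
         (cong (_xor parity vs b) (not-distribʳ-xor σ (parity vs a))))
... | false | true  = cong (λ τ → a , b , τ) (not-distribʳ-xor (σ xor parity vs a) (parity vs b))
... | false | false = refl

support : (ℕ → Bool) → ℕ → List ℕ
support h zero    = []
support h (suc n) = if h n then n ∷ support h n else support h n

support-< : ∀ h n → All (_< n) (support h n)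
support-< h zero = []
support-< h (suc n) with h n
... | true  = n<1+n n ∷ All.map m<n⇒m<1+n (support-< h n)
... | false = All.map m<n⇒m<1+n (support-< h n)

parity-support-≥ : ∀ h n x → n ≤ x → parity (support h n) x ≡ false
parity-support-≥ h zero x _ = refl
parity-support-≥ h (suc n) x n<x with h n
... | true rewrite ≢⇒≡ᵇ-false (>⇒≢ n<x) = parity-support-≥ h n x (<⇒≤ n<x)
... | false = parity-support-≥ h n x (<⇒≤ n<x)

parity-support : ∀ h n x → x < n → parity (support h n) x ≡ h x
parity-support h (suc n) x (s≤s x≤n) with m≤n⇒m<n∨m≡n x≤n
... | inj₂ refl with h x
...   | true  rewrite ≡ᵇ-refl x | parity-support-≥ h x x ≤-refl = refl
...   | false = parity-support-≥ h x x ≤-refl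
parity-support h (suc n) x (s≤s x≤n) | inj₁ x<n with h n
...   | true  rewrite ≢⇒≡ᵇ-false (<⇒≢ x<n) = parity-support h n x x<n
...   | false = parity-support h n x x<n

switchAll-SwitchEq : ∀ vs V es → All (_< V) vs → SwitchEq (mkSG V es) (mkSG V (map (switchAll vs) es))
switchAll-SwitchEq [] V es [] = subst (SwitchEq (mkSG V es) ∘ mkSG V) (sym (map-id es)) sw-refl
switchAll-SwitchEq (v ∷ vs) V es (v<V ∷ vs<V) =
  subst (SwitchEq (mkSG V es)) (cong (mkSG V) (sym (map-∘ es)))
    (sw-step v v<V (switchAll-SwitchEq vs V es vs<V))

switchedBy : (ℕ → Bool) → SG → SG
switchedBy h G = mkSG (V G) (map (switchBy h) (E G))

switchBy-SwitchEq : ∀ h G → All Loopless (E G) → All (Below (V G)) (E G) → SwitchEq G (switchedBy h G)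
switchBy-SwitchEq h G loopless below =
  subst (SwitchEq G ∘ mkSG (V G)) (map-cong-local (All.zipWith agree (loopless , below)))
    (switchAll-SwitchEq (support h (V G)) (V G) (E G) (support-< h (V G)))
  where
    agree : ∀ {e} → Loopless e × Below (V G) e → switchAll (support h (V G)) e ≡ switchBy h e
    agree {a , b , σ} (a≢b , a<V , b<V) =
      trans (switchAll-parity (support h (V G)) σ a≢b)
            (cong₂ (λ p q → a , b , (σ xor p) xor q)
                   (parity-support h (V G) a a<V) (parity-support h (V G) b b<V))

piece : Block → Piece
piece (edge _)  = K2+
piece (digon _) = Dcyc

stringSP : Block → SP
stringSP = pieceSP ∘ piece

chainNext : List Block → ℕ → ℕ
chainNext []       k = k
chainNext (_ ∷ cs) k = chainNext cs (suc k)

chainNext-≥ : ∀ cs k → k ≤ chainNext cs k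
chainNext-≥ []       k = ≤-refl
chainNext-≥ (_ ∷ cs) k = ≤-trans (n≤1+n k) (chainNext-≥ cs (suc k))

Flat : (Block → SP) → Set
Flat f = ∀ c s t k → proj₂ (build (f c) s t k) ≡ k

blockSP-flat : Flat blockSP
blockSP-flat (edge _)  s t k = refl
blockSP-flat (digon _) s t k = refl

stringSP-flat : Flat stringSP
stringSP-flat (edge _)  s t k = refl
stringSP-flat (digon _) s t k = refl

chain-next : ∀ f → Flat f → ∀ c cs s t k → proj₂ (buildSer (map f (c ∷ cs)) s t k) ≡ chainNext cs k
chain-next f flat c []       s t k = flat c s t k
chain-next f flat c (d ∷ cs) s t k rewrite flat c s k (suc k) = chain-next f flat d cs k t (suc k)

Positive : Block → Bool → Bool → Set
Positive (edge σ)  x y = (σ xor x) xor y ≡ true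
Positive (digon _) x y = ⊤

ChainPositive : (ℕ → Bool) → Block → List Block → ℕ → ℕ → ℕ → Set
ChainPositive h c []       s t k = Positive c (h s) (h t)
ChainPositive h c (d ∷ cs) s t k = Positive c (h s) (h k) × ChainPositive h d cs k t (suc k)

chainPositive-cong : ∀ {h h′} c cs s t k → (∀ {x} → Within s t k (chainNext cs k) x → h x ≡ h′ x) →
  ChainPositive h c cs s t k → ChainPositive h′ c cs s t k
chainPositive-cong c [] s t k agree =
  subst₂ (Positive c) (agree (at-source refl)) (agree (at-target refl))
chainPositive-cong {h} {h′} c (d ∷ cs) s t k agree (positive , rest) =
  subst₂ (Positive c) (agree (at-source refl)) (agree (fresh ≤-refl k<next)) positive ,
  chainPositive-cong d cs k t (suc k) agree′ rest
  where
    k<next : k < chainNext cs (suc k)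
    k<next = chainNext-≥ cs (suc k)
    agree′ : ∀ {x} → Within k t (suc k) (chainNext cs (suc k)) x → h x ≡ h′ x
    agree′ (at-source refl) = agree (fresh ≤-refl k<next)
    agree′ (at-target x≡t) = agree (at-target x≡t)
    agree′ (fresh k<x x<next) = agree (fresh (<⇒≤ k<x) x<next)

carry : Block → Bool → Bool
carry (edge σ)  b = not (σ xor b)
carry (digon _) b = b

carry-positive : ∀ c b → Positive c b (carry c b)
carry-positive (edge σ)  b = xor-inverseʳ (σ xor b)
carry-positive (digon _) b = tt

potential : Block → List Block → ℕ → ℕ → ℕ → Bool → ℕ → Bool
potential c []       s t k b x = if x ≡ᵇ s then b else carry c b
potential c (d ∷ cs) s t k b x = if x ≡ᵇ s then b else potential d cs k t (suc k) (carry c b) x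

potential-source : ∀ c cs s t k b → potential c cs s t k b s ≡ b
potential-source c []       s t k b rewrite ≡ᵇ-refl s = refl
potential-source c (d ∷ cs) s t k b rewrite ≡ᵇ-refl s = refl

potential-rest : ∀ c d cs s t k b {x} → x ≢ s →
  potential c (d ∷ cs) s t k b x ≡ potential d cs k t (suc k) (carry c b) x
potential-rest c d cs s t k b x≢s rewrite ≢⇒≡ᵇ-false x≢s = refl

potential-positive : ∀ c cs s t k b → s ≢ t → s < k → t < k →
  ChainPositive (potential c cs s t k b) c cs s t k
potential-positive c [] s t k b s≢t _ _ rewrite ≢⇒≡ᵇ-false (≢-sym s≢t) =
  subst (λ x → Positive c x (carry c b)) (sym (potential-source c [] s t k b)) (carry-positive c b)
potential-positive c (d ∷ cs) s t k b s≢t s<k t<k =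
  subst₂ (Positive c) (sym (potential-source c (d ∷ cs) s t k b)) (sym potential-k) (carry-positive c b) ,
  chainPositive-cong d cs k t (suc k) (λ x∈ → sym (potential-rest c d cs s t k b (≢s x∈)))
    (potential-positive d cs k t (suc k) (carry c b) (>⇒≢ t<k) (n<1+n k) (m<n⇒m<1+n t<k))
  where
    potential-k : potential c (d ∷ cs) s t k b k ≡ carry c b
    potential-k =
      trans (potential-rest c d cs s t k b (>⇒≢ s<k)) (potential-source d cs k t (suc k) (carry c b))
    ≢s : ∀ {x} → Within k t (suc k) (chainNext cs (suc k)) x → x ≢ s
    ≢s (at-source refl) = >⇒≢ s<k
    ≢s (at-target refl) = ≢-sym s≢t
    ≢s (fresh k<x _)    = >⇒≢ (<-trans s<k k<x)

not-xor-xor : ∀ a x y → (not a xor x) xor y ≡ not ((a xor x) xor y)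
not-xor-xor a x y = trans (cong (_xor y) (sym (not-distribˡ-xor a x))) (sym (not-distribˡ-xor (a xor x) y))

complementary-↭ : ∀ x {u w : ℕ} →
  _↭_ {A = Edge} ((u , w , x) ∷ (u , w , not x) ∷ []) ((u , w , true) ∷ (u , w , false) ∷ [])
complementary-↭ true  = ↭-refl
complementary-↭ false = swap _ _ ↭-refl

block-↭ : ∀ h c u w k → Positive c (h u) (h w) →
  map (switchBy h) (proj₁ (build (blockSP c) u w k)) ↭ proj₁ (build (stringSP c) u w k)
block-↭ h (edge σ) u w k positive rewrite positive = ↭-refl
block-↭ h (digon a) u w k _ rewrite not-xor-xor a (h u) (h w) = complementary-↭ ((a xor h u) xor h w)

chain-↭ : ∀ h c cs s t k → ChainPositive h c cs s t k →
  map (switchBy h) (proj₁ (buildSer (map blockSP (c ∷ cs)) s t k)) ↭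
  proj₁ (buildSer (map stringSP (c ∷ cs)) s t k)
chain-↭ h c [] s t k positive = block-↭ h c s t k positive
chain-↭ h c (d ∷ cs) s t k (positive , rest)
  rewrite blockSP-flat c s k (suc k) | stringSP-flat c s k (suc k) =
  subst (_↭ _) (sym (map-++ (switchBy h) (proj₁ (build (blockSP c) s k (suc k)))
                                          (proj₁ (buildSer (map blockSP (d ∷ cs)) k t (suc k)))))
    (PermP.++⁺ (block-↭ h c s k (suc k) positive) (chain-↭ h d cs k t (suc k) rest))

TwoCycle : ℕ → ℕ → Edge → Edge → Set
TwoCycle v w e e′ = SameEnds e (v , w , true) × SameEnds e′ (v , w , true)

junction-twoCycle : ∀ c d cs s t k → isEdge c ∧ isEdge d ≡ false →
  Σ ℕ λ w → SomePair (TwoCycle k w) (proj₁ (buildSer (map stringSP (c ∷ d ∷ cs)) s t k))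
junction-twoCycle (digon _) d cs s t k _ =
  s , here (here (inj₂ (refl , refl) , inj₂ (refl , refl)))
junction-twoCycle (edge _) (digon _) [] s t k _ =
  t , there (here (here (inj₁ (refl , refl) , inj₁ (refl , refl))))
junction-twoCycle (edge _) (digon _) (_ ∷ _) s t k _ =
  suc k , there (here (here (inj₁ (refl , refl) , inj₁ (refl , refl))))

chain-twoCycle : ∀ c cs s t k → NoAdjacentEdges c cs → ∀ v → k ≤ v → v < chainNext cs k →
  Σ ℕ λ w → SomePair (TwoCycle v w) (proj₁ (buildSer (map stringSP (c ∷ cs)) s t k))
chain-twoCycle c [] s t k _ v k≤v v<k = ⊥-elim (<-irrefl refl (<-≤-trans v<k k≤v))
chain-twoCycle c (d ∷ cs) s t k (noAdj , noAdjs) v k≤v v<next with m≤n⇒m<n∨m≡n k≤v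
... | inj₂ refl = junction-twoCycle c d cs s t k noAdj
... | inj₁ k<v rewrite stringSP-flat c s k (suc k)
  with chain-twoCycle d cs k t (suc k) noAdjs v k<v v<next
...   | w , p = w , somePair-++ʳ (proj₁ (build (stringSP c) s k (suc k))) p

stringOf : Block → List Block → SG
stringOf c cs = graphOf (ser (map stringSP (c ∷ cs)))

stringOf-pieces : ∀ c cs → stringOf c cs ≡ stringGraph (map piece (c ∷ cs))
stringOf-pieces c cs = cong (graphOf ∘ ser) (map-∘ (c ∷ cs))

InnerVerticesInTwoCycles : SG → Set
InnerVerticesInTwoCycles G = ∀ v → NonTerminal G v → InTwoCycle G v

string-twoCycles : ∀ c cs → NoAdjacentEdges c cs → InnerVerticesInTwoCycles (stringOf c cs)
string-twoCycles c cs noAdj v (2≤v , v<V)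
  with chain-twoCycle c cs 0 1 2 noAdj v 2≤v
         (subst (v <_) (chain-next stringSP stringSP-flat c cs 0 1 2) v<V)
... | w , p with somePair-indices p
...   | i , j , i≢j , ends-i , ends-j = i , j , w , i≢j , ends-i , ends-j

positive-iso : ∀ h c cs → ChainPositive h c cs 0 1 2 → Iso (switchedBy h (chainGraph c cs)) (stringOf c cs)
positive-iso h c cs positive =
  V≡ , (λ x → x) , (λ x → x) , (λ _ → refl) , (λ _ → refl) , refl , refl ,
  (λ x → subst (x <_) V≡) , PermP.map⁺ norm (chain-↭ h c cs 0 1 2 positive)
  where
    V≡ : V (chainGraph c cs) ≡ V (stringOf c cs)
    V≡ = trans (chain-next blockSP blockSP-flat c cs 0 1 2)
               (sym (chain-next stringSP stringSP-flat c cs 0 1 2))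

SwitchesToString : SG → Set
SwitchesToString G = Σ SG λ H → SwitchEq G H × IsString H

chain-switchesToString : ∀ c cs → NoAdjacentEdges c cs → SwitchesToString (chainGraph c cs)
chain-switchesToString c cs noAdj =
  switchedBy h (chainGraph c cs) , switchBy-SwitchEq h (chainGraph c cs) loopless below ,
  map piece (c ∷ cs) , (λ ()) ,
  subst InnerVerticesInTwoCycles (stringOf-pieces c cs) (string-twoCycles c cs noAdj) ,
  subst (Iso _) (stringOf-pieces c cs)
    (positive-iso h c cs (potential-positive c cs 0 1 2 false (λ ()) z<s (s<s z<s)))
  where
    h = potential c cs 0 1 2 false
    loopless = buildSer-loopless (map blockSP (c ∷ cs)) 0 1 2 (λ ()) z<s (s<s z<s)
    2≤V = buildSer-≤ (map blockSP (c ∷ cs)) 0 1 2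
    below = within-below (<-≤-trans z<s 2≤V) (<-≤-trans (s<s z<s) 2≤V)
                         (buildSer-within (map blockSP (c ∷ cs)) 0 1 2)

lemma11 : (G : SP) → Canonical G → depth G ≤ 2 → Reduced (graphOf G) →
    Σ SG (λ H → SwitchEq (graphOf G) H × IsString H)
lemma11 G canonical depth≤2 reduced with reduced-depth≤2-chain G canonical depth≤2 reduced
... | c , cs , noAdj , graphOf≡chain =
  subst SwitchesToString (sym graphOf≡chain) (chain-switchesToString c cs noAdj)
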